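{- Let $d,m$ be positive integers and $g=(\psi,(g_0,\ldots,g_{d-1}))\in W(d,m)$ with $g_i=\lambda(a_i,b_i)$. (1) $g$ is a $(dm)$-cycle if and only if $\psi$ is a $d$-cycle, written $\psi=(i_0,i_1,\ldots,i_{d-1})$ with $i_0=0$ (so $\psi(i_j)=i_{j+1}$), and the forward cycle product \[ g_{i_0}g_{i_1}\cdots g_{i_{d-1}}=\lambda\Big(\prod_{j=0}^{d-1}a_j,\ \sum_{j=0}^{d-1}\Big(\prod_{k=j+1}^{d-1}a_{i_k}\Big)b_{i_j}\Big) \] is an $m$-cycle on $\mathbb{Z}/m\mathbb{Z}$, i.e. (a) $\prod_{j=0}^{d-1}a_j\equiv1\pmod{\operatorname{rad}'(m)}$ and (b) $\gcd\big(m,\sum_{j=0}^{d-1}(\prod_{k=j+1}^{d-1}a_{i_k})b_{i_j}\big)=1$. (2) $g$ is an involution (i.e. $g^2=1$) if and only if $\psi$ is an involution in $\operatorname{Sym}(d)$, say $\psi=(i_0,i_1)(i_2,i_3)\cdots(i_{2k-2},i_{2k-1})(i_{2k})(i_{2k+1})\cdots(i_{d-1})$ with $\{i_0,\ldots,i_{d-1}\}=\{0,\ldots,d-1\}$, and: (a) for $j=0,1,\ldots,k-1$, $g_{i_{2j+1}}=g_{i_{2j}}^{ -1}$; (b) for $j=2k,\ldots,d-1$, $g_{i_j}$ is an involution in $\operatorname{Hol}(\mathbb{Z}/m\mathbb{Z})$.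
   Context: Permutations act on the right; for permutations $\sigma,\tau$, $\sigma\tau$ means first $\sigma$, then $\tau$. $\operatorname{Sym}(d)$ is the symmetric group on $\{0,\ldots,d-1\}$. $\operatorname{Hol}(\mathbb{Z}/m\mathbb{Z})$ consists of the permutations $\lambda(a,b):x\mapsto ax+b$ of $\mathbb{Z}/m\mathbb{Z}$ with $\gcd(a,m)=1$; so $\lambda(a,b)\lambda(a',b')=\lambda(aa',a'b+b')$. $W(d,m)=\operatorname{Hol}(\mathbb{Z}/m\mathbb{Z})\wr_{\mathrm{imp}}\operatorname{Sym}(d)$: pairs $(\sigma,(g_0,\ldots,g_{d-1}))$ with multiplication $(\sigma,(g_i))(\tau,(h_i))=(\sigma\tau,(g_{\tau^{ -1}(i)}h_i))$, acting on $\mathbb{Z}/m\mathbb{Z}\times\{0,\ldots,d-1\}$ by $(x,i)\mapsto(x^{g_{\sigma(i)}},\sigma(i))$. $\operatorname{rad}(m)$ is the product of the distinct primes dividing $m$, and $\operatorname{rad}'(m):=\operatorname{rad}(m)$ if $4\nmid m$, $\operatorname{rad}'(m):=2\operatorname{rad}(m)$ if $4\mid m$. -}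

module Defs where

open import Data.Nat using (ℕ; zero; suc; _+_; _*_; _∸_; NonZero)
open import Data.Nat.DivMod using (_mod_)
open import Data.Nat.Divisibility using (_∣?_)
open import Data.Nat.Primality using (prime?)
open import Data.Fin using (Fin; toℕ)
import Data.Fin as F
open import Data.Fin.Permutation using (Permutation′; _⟨$⟩ʳ_)
open import Data.List using (List; filter; upTo; foldr)
open import Data.Product using (_×_; _,_; ∃-syntax)
open import Relation.Nullary.Decidable using (_×-dec_; yes; no)
open import Relation.Binary.PropositionalEquality using (_≡_)

iter : {A : Set} → (A → A) → ℕ → A → A
iter f zero x = x
iter f (suc n) x = f (iter f n x)

-- a permutation f of a finite set A (|A| = N) is an N-cycle iff
-- ⟨f⟩ acts transitively, i.e. a single cycle through all points
IsFullCycle : {A : Set} → (A → A) → Set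
IsFullCycle {A} f = (x y : A) → ∃[ n ] iter f n x ≡ y

rad : ℕ → ℕ
rad m = foldr _*_ 1 (filter (λ p → prime? p ×-dec (p ∣? m)) (upTo (suc m)))

rad′ : ℕ → ℕ
rad′ m with 4 ∣? m
... | yes _ = 2 * rad m
... | no _ = rad m

fin0 : (d : ℕ) → .{{NonZero d}} → Fin d
fin0 (suc d) = F.zero

-- λ(a,b) : x ↦ a x + b on ℤ/mℤ = Fin m
hol : (m : ℕ) → .{{NonZero m}} → ℕ → ℕ → Fin m → Fin m
hol m a b x = (a * toℕ x + b) mod m

ΠFin : (n : ℕ) → (Fin n → ℕ) → ℕ
ΠFin zero f = 1
ΠFin (suc n) f = f F.zero * ΠFin n (λ i → f (F.suc i))

prodFrom : ℕ → ℕ → (ℕ → ℕ) → ℕ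
prodFrom lo zero f = 1
prodFrom lo (suc n) f = f lo * prodFrom (suc lo) n f

sumTo : ℕ → (ℕ → ℕ) → ℕ
sumTo zero f = 0
sumTo (suc n) f = sumTo n f + f n

module _ (d m : ℕ) .{{_ : NonZero d}} .{{_ : NonZero m}}
         (ψ : Permutation′ d) (a b : Fin d → ℕ) where

  -- the action of g = (ψ,(λ(a_i,b_i))_i) ∈ W(d,m) on ℤ/mℤ × {0..d-1}:
  -- (x,i) ↦ (x^{g_{ψ(i)}}, ψ(i))
  wAct : Fin m × Fin d → Fin m × Fin d
  wAct (x , i) = hol m (a (ψ ⟨$⟩ʳ i)) (b (ψ ⟨$⟩ʳ i)) x , ψ ⟨$⟩ʳ i

  idx : ℕ → Fin d
  idx j = iter (ψ ⟨$⟩ʳ_) j (fin0 d)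

  -- x ↦ x^{g_{i_0} g_{i_1} ⋯ g_{i_{n-1}}} (right action: g_{i_0} first)
  cycAct : ℕ → Fin m → Fin m
  cycAct zero x = x
  cycAct (suc n) x = hol m (a (idx n)) (b (idx n)) (cycAct n x)

  cycleProduct : Fin m → Fin m
  cycleProduct = cycAct d

  cycleB : ℕ
  cycleB = sumTo d (λ j → prodFrom (suc j) (d ∸ suc j) (λ k → a (idx k)) * b (idx j))

-- An element g = (ψ, (g_i)) of W(d, m) is a skew product over ψ: starting in the fibre over
-- i₀ = 0 it applies g_{i₁}, g_{i₂}, … while ψ walks along the indices. So g is a (dm)-cycle iff
-- ψ is a d-cycle and the first-return map to that fibre is an m-cycle, and the return map is
-- conjugate, by g_{i₀}, to the cycle product g_{i₀} ⋯ g_{i_{d-1}} = λ(A, B) with A = ∏ a_j.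
--
-- That λ(A, B) is an m-cycle iff rad′(m) ∣ A − 1 and gcd(m, B) = 1 is the Hull–Dobell theorem.
-- The orbit of 0 is n ↦ B (1 + A + ⋯ + A^{n-1}), and when rad′(m) ∣ A − 1 this geometric sum is
-- divisible by m exactly when n is, which is proved one prime factor of m at a time. Conversely,
-- a prime p ∣ m with p ∤ A − 1 leaves a residue class mod p invariant, and A ≡ 3 (mod 4) with
-- 4 ∣ m leaves the pair of classes {0, B} mod 4 invariant.
--
-- Finally g² = 1 is checked pointwise: g²(x, i) = (x^{g_{ψ(i)} g_{ψ²(i)}}, ψ²(i)).

module Submission where

open import Data.Nat
open import Data.Nat.Properties
open import Data.Nat.DivMod
open import Data.Nat.Divisibility
open import Data.Nat.Primality
open import Data.Nat.Primality.Factorisation using (factorise; factorisationHasAllPrimeFactors)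
open import Data.Nat.Coprimality using (Coprime; coprime-divisor; gcd≡1⇒coprime)
import Data.Nat.Coprimality as Coprime
open import Data.Nat.GCD using (gcd; gcd[m,n]∣m; gcd[m,n]∣n; gcd-greatest; gcd-zeroˡ)
open import Data.Nat.ListAction using (product)
open import Data.Nat.ListAction.Properties using (∈⇒∣product)
open import Data.Nat.Tactic.RingSolver using (solve-∀)
open import Data.Integer using (+_; _-_)
import Data.Integer.Divisibility as ℤ
open import Data.Fin using (Fin; toℕ; fromℕ<; fromℕ; inject₁; punchOut)
import Data.Fin as Fin
open import Data.Fin.Properties
  using (toℕ-injective; toℕ-fromℕ<; toℕ<n; toℕ-inject₁; toℕ-fromℕ; any?; punchOut-injective; injective⇒≤)
open import Data.Fin.Permutation using (Permutation′; _⟨$⟩ʳ_; permutation)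
open import Data.List.Base using ([]; _∷_; filter; upTo)
open import Data.List.Relation.Unary.All using (All; []; _∷_)
import Data.List.Relation.Unary.All as All
open import Data.List.Relation.Unary.All.Properties using (all-filter)
open import Data.List.Relation.Unary.AllPairs using ([]; _∷_)
open import Data.List.Relation.Unary.Unique.Propositional using (Unique)
open import Data.List.Relation.Unary.Unique.Propositional.Properties using (upTo⁺; filter⁺)
open import Data.List.Membership.Propositional.Properties using (∈-upTo⁺; ∈-filter⁺)
open import Data.Product
open import Data.Sum using (_⊎_; inj₁; inj₂)
open import Data.Empty
open import Function.Base using (_∘_)
open import Function.Bundles using (_⇔_; mk⇔; module Equivalence; module Injection)
open import Function.Definitions using (Injective)
open import Function.Properties.Equivalence using () renaming (sym to ⇔-sym; trans to ⇔-trans)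
open import Function.Properties.Inverse using (↔⇒↣)
open import Relation.Nullary
open import Relation.Binary.PropositionalEquality
open import Algebra.Properties.CommutativeMonoid.Sum *-1-commutativeMonoid
  using (sum; sum-permute; sum-init-last; sum-cong-≗)
open import Defs

open Equivalence using (to; from)

private variable
  A : Set
  c m n p q : ℕ

-- Iteration and full cycles

iter-+ : (f : A → A) (m n : ℕ) (x : A) → iter f (m + n) x ≡ iter f m (iter f n x)
iter-+ f zero    n x = refl
iter-+ f (suc m) n x = cong f (iter-+ f m n x)

iter-cong : {f g : A → A} → (∀ x → f x ≡ g x) → ∀ n x → iter f n x ≡ iter g n x
iter-cong f≗g zero    x = refl
iter-cong {g = g} f≗g (suc n) x = trans (f≗g _) (cong g (iter-cong f≗g n x))

iter-injective : {f : A → A} → Injective _≡_ _≡_ f → ∀ n → Injective _≡_ _≡_ (iter f n)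
iter-injective f-inj zero    eq = eq
iter-injective f-inj (suc n) eq = iter-injective f-inj n (f-inj eq)

module _ (f : A → A) {x : A} (p : ℕ) (fᵖx≡x : iter f p x ≡ x) where

  iter-*-period : ∀ q → iter f (q * p) x ≡ x
  iter-*-period zero    = refl
  iter-*-period (suc q) = trans (iter-+ f p (q * p) x)
    (trans (cong (iter f p) (iter-*-period q)) fᵖx≡x)

  iter-%-period : .{{_ : NonZero p}} → ∀ n → iter f n x ≡ iter f (n % p) x
  iter-%-period n = begin
    iter f n x                              ≡⟨ cong (λ k → iter f k x) (m≡m%n+[m/n]*n n p) ⟩
    iter f (n % p + n / p * p) x            ≡⟨ iter-+ f (n % p) (n / p * p) x ⟩
    iter f (n % p) (iter f (n / p * p) x)   ≡⟨ cong (iter f (n % p)) (iter-*-period (n / p)) ⟩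
    iter f (n % p) x                        ∎
    where open ≡-Reasoning

IsFullCycle-cong : {f g : A → A} → (∀ x → f x ≡ g x) → IsFullCycle f ⇔ IsFullCycle g
IsFullCycle-cong f≗g = mk⇔ (transfer f≗g) (transfer (sym ∘ f≗g))
  where
  transfer : ∀ {f g : A → A} → (∀ x → f x ≡ g x) → IsFullCycle f → IsFullCycle g
  transfer f≗g full x y with full x y
  ... | n , fⁿx≡y = n , trans (sym (iter-cong f≗g n x)) fⁿx≡y

injective⇒surjective : ∀ {n} (f : Fin n → Fin n) → Injective _≡_ _≡_ f → ∀ y → ∃[ x ] f x ≡ y
injective⇒surjective f f-inj y with any? (λ x → f x Fin.≟ y)
... | yes hit = hit
injective⇒surjective {suc n} f f-inj y | no miss =
  ⊥-elim (<-irrefl refl (injective⇒≤ {f = avoid} avoid-inj))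
  where
  avoid : Fin (suc n) → Fin n
  avoid x = punchOut {i = y} (λ eq → miss (x , sym eq))
  avoid-inj : Injective _≡_ _≡_ avoid
  avoid-inj {x} {x′} eq = f-inj (punchOut-injective (λ e → miss (x , sym e)) (λ e → miss (x′ , sym e)) eq)

injective⇒permutation : ∀ {n} (f : Fin n → Fin n) → Injective _≡_ _≡_ f → Permutation′ n
injective⇒permutation f f-inj =
  permutation f f⁻¹ (λ y → proj₂ (surjective y)) (λ x → f-inj (proj₂ (surjective (f x))))
  where
  surjective : ∀ y → ∃[ x ] f x ≡ y
  surjective = injective⇒surjective f f-inj
  f⁻¹ : Fin _ → Fin _
  f⁻¹ y = proj₁ (surjective y)

ExactPeriod : (A → A) → A → ℕ → Set
ExactPeriod f z p = ∀ n → iter f n z ≡ z ⇔ p ∣ n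

module _ {m : ℕ} .{{_ : NonZero m}} (f : Fin m → Fin m) (f-inj : Injective _≡_ _≡_ f) (z : Fin m) where

  orbit : Fin m → Fin m
  orbit t = iter f (toℕ t) z

  private
    return-to-start : ∀ {i j} → i ≤ j → iter f i z ≡ iter f j z → iter f (j ∸ i) z ≡ z
    return-to-start {i} {j} i≤j eq = iter-injective f-inj i (begin
      iter f i (iter f (j ∸ i) z) ≡⟨ iter-+ f i (j ∸ i) z ⟨
      iter f (i + (j ∸ i)) z      ≡⟨ cong (λ k → iter f k z) (m+[n∸m]≡n i≤j) ⟩
      iter f j z                  ≡⟨ eq ⟨
      iter f i z                  ∎)
      where open ≡-Reasoning

  -- a return time shorter than m would confine the orbit of z to fewer than m points
  fullCycle⇒period≥ : IsFullCycle f → ∀ {p} → 0 < p → iter f p z ≡ z → m ≤ p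
  fullCycle⇒period≥ full {p} 0<p fᵖz≡z = injective⇒≤ {f = time} time-inj
    where
    instance
      _ : NonZero p
      _ = >-nonZero 0<p
    time : Fin m → Fin p
    time y = proj₁ (full z y) mod p
    time-inj : Injective _≡_ _≡_ time
    time-inj {y} {y′} eq = begin
      y                                  ≡⟨ proj₂ (full z y) ⟨
      iter f (proj₁ (full z y)) z        ≡⟨ iter-%-period f p fᵖz≡z _ ⟩
      iter f (proj₁ (full z y) % p) z    ≡⟨ cong (λ k → iter f k z) (trans (sym (toℕ-fromℕ< _))
                                                                     (trans (cong toℕ eq) (toℕ-fromℕ< _))) ⟩
      iter f (proj₁ (full z y′) % p) z   ≡⟨ iter-%-period f p fᵖz≡z _ ⟨
      iter f (proj₁ (full z y′)) z       ≡⟨ proj₂ (full z y′) ⟩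
      y′                                 ∎
      where open ≡-Reasoning

  private
    NoEarlyReturn : Set
    NoEarlyReturn = ∀ {p} → 0 < p → iter f p z ≡ z → m ≤ p

    ordered-injective : NoEarlyReturn → ∀ {i j} → i ≤ j → j < m → iter f i z ≡ iter f j z → i ≡ j
    ordered-injective noEarly {i} {j} i≤j j<m eq with m≤n⇒m<n∨m≡n i≤j
    ... | inj₂ i≡j = i≡j
    ... | inj₁ i<j = ⊥-elim (<-irrefl refl (begin-strict
      m      ≤⟨ noEarly (m<n⇒0<n∸m i<j) (return-to-start i≤j eq) ⟩
      j ∸ i  ≤⟨ m∸n≤m j i ⟩
      j      <⟨ j<m ⟩
      m      ∎))
      where open ≤-Reasoning

    orbit-injective : NoEarlyReturn → Injective _≡_ _≡_ orbit
    orbit-injective noEarly {t} {t′} eq with ≤-total (toℕ t) (toℕ t′)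
    ... | inj₁ t≤t′ = toℕ-injective (ordered-injective noEarly t≤t′ (toℕ<n t′) eq)
    ... | inj₂ t′≤t = toℕ-injective (sym (ordered-injective noEarly t′≤t (toℕ<n t) (sym eq)))

  fullCycle⇒orbit-injective : IsFullCycle f → Injective _≡_ _≡_ orbit
  fullCycle⇒orbit-injective full = orbit-injective (fullCycle⇒period≥ full)

  fullCycle⇒exactPeriod : IsFullCycle f → ExactPeriod f z m
  fullCycle⇒exactPeriod full n = mk⇔ returns⇒∣ ∣⇒returns
    where
    returns-after-m : iter f m z ≡ z
    returns-after-m with injective⇒surjective orbit (fullCycle⇒orbit-injective full) (iter f m z)
    ... | t , fᵗz≡fᵐz = returns-before-m (toℕ t) (toℕ<n t) fᵗz≡fᵐz
      where
      returns-before-m : ∀ k → k < m → iter f k z ≡ iter f m z → iter f m z ≡ z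
      returns-before-m zero    _   eq = sym eq
      returns-before-m (suc k) 1+k<m eq = ⊥-elim (<-irrefl refl (begin-strict
        m          ≤⟨ fullCycle⇒period≥ full (m<n⇒0<n∸m 1+k<m) (return-to-start (<⇒≤ 1+k<m) eq) ⟩
        m ∸ suc k  <⟨ ∸-monoʳ-< z<s (<⇒≤ 1+k<m) ⟩
        m          ∎))
        where open ≤-Reasoning
    returns⇒∣ : iter f n z ≡ z → m ∣ n
    returns⇒∣ fⁿz≡z = m%n≡0⇒n∣m n m (sym (ordered-injective (fullCycle⇒period≥ full) z≤n (m%n<n n m)
      (sym (trans (sym (iter-%-period f m returns-after-m n)) fⁿz≡z))))
    ∣⇒returns : m ∣ n → iter f n z ≡ z
    ∣⇒returns (divides q refl) = iter-*-period f m returns-after-m q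

  fullCycle⇒returns : IsFullCycle f → iter f m z ≡ z
  fullCycle⇒returns full = from (fullCycle⇒exactPeriod full m) ∣-refl

  exactPeriod⇒fullCycle : ExactPeriod f z m → IsFullCycle f
  exactPeriod⇒fullCycle period x y = toℕ t + (m ∸ toℕ s) , (begin
    iter f (toℕ t + (m ∸ toℕ s)) x                   ≡⟨ iter-+ f (toℕ t) _ x ⟩
    iter f (toℕ t) (iter f (m ∸ toℕ s) x)            ≡⟨ cong (iter f (toℕ t) ∘ iter f (m ∸ toℕ s)) fˢz≡x ⟨
    iter f (toℕ t) (iter f (m ∸ toℕ s) (orbit s))    ≡⟨ cong (iter f (toℕ t)) (iter-+ f (m ∸ toℕ s) (toℕ s) z) ⟨
    iter f (toℕ t) (iter f (m ∸ toℕ s + toℕ s) z)    ≡⟨ cong (λ k → iter f (toℕ t) (iter f k z)) (m∸n+n≡m (<⇒≤ (toℕ<n s))) ⟩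
    iter f (toℕ t) (iter f m z)                      ≡⟨ cong (iter f (toℕ t)) (from (period m) ∣-refl) ⟩
    orbit t                                          ≡⟨ fᵗz≡y ⟩
    y                                                ∎)
    where
    open ≡-Reasoning
    noEarly : NoEarlyReturn
    noEarly {p} 0<p fᵖz≡z = ∣⇒≤ {{>-nonZero 0<p}} (to (period p) fᵖz≡z)
    surjective : ∀ y → ∃[ t ] orbit t ≡ y
    surjective = injective⇒surjective orbit (orbit-injective noEarly)
    s t : Fin m
    s = proj₁ (surjective x)
    t = proj₁ (surjective y)
    fˢz≡x : orbit s ≡ x
    fˢz≡x = proj₂ (surjective x)
    fᵗz≡y : orbit t ≡ y
    fᵗz≡y = proj₂ (surjective y)

fullCycle-invariant : {f : A → A} → IsFullCycle f → (P : A → Set) →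
                      (∀ x → P x → P (f x)) → ∀ {x₀} → P x₀ → ∀ y → P y
fullCycle-invariant {f = f} full P P-step {x₀} P[x₀] y =
  subst P (proj₂ (full x₀ y)) (P-iter (proj₁ (full x₀ y)))
  where
  P-iter : ∀ n → P (iter f n x₀)
  P-iter zero    = P[x₀]
  P-iter (suc n) = P-step _ (P-iter n)

fullCycle-conjugate : {B : Set} {f : A → A} {g : B → B} (φ : A → B) →
                      Injective _≡_ _≡_ φ → (∀ y → ∃[ x ] φ x ≡ y) → (∀ x → φ (f x) ≡ g (φ x)) →
                      IsFullCycle f ⇔ IsFullCycle g
fullCycle-conjugate {f = f} {g} φ φ-inj φ-surj φf≡gφ = mk⇔ ⇒ ⇐
  where
  φ-iter : ∀ n x → φ (iter f n x) ≡ iter g n (φ x)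
  φ-iter zero    x = refl
  φ-iter (suc n) x = trans (φf≡gφ _) (cong g (φ-iter n x))
  ⇒ : IsFullCycle f → IsFullCycle g
  ⇒ full x y with φ-surj x | φ-surj y
  ... | x′ , refl | y′ , refl with full x′ y′
  ...   | n , fⁿx′≡y′ = n , trans (sym (φ-iter n x′)) (cong φ fⁿx′≡y′)
  ⇐ : IsFullCycle g → IsFullCycle f
  ⇐ full x y with full (φ x) (φ y)
  ... | n , gⁿφx≡φy = n , φ-inj (trans (φ-iter n x) gⁿφx≡φy)

-- Geometric sums

geomSum : ℕ → ℕ → ℕ
geomSum a zero    = 0
geomSum a (suc n) = 1 + a * geomSum a n

triangular : ℕ → ℕ
triangular n = sumTo n (λ j → j)

geomSum-+ : ∀ a m n → geomSum a (m + n) ≡ geomSum a m + a ^ m * geomSum a n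
geomSum-+ a zero    n = sym (+-identityʳ (geomSum a n))
geomSum-+ a (suc m) n = begin
  1 + a * geomSum a (m + n)                            ≡⟨ cong (λ s → 1 + a * s) (geomSum-+ a m n) ⟩
  1 + a * (geomSum a m + a ^ m * geomSum a n)          ≡⟨ distrib a (geomSum a m) (a ^ m) (geomSum a n) ⟩
  1 + a * geomSum a m + a * a ^ m * geomSum a n        ∎
  where
  open ≡-Reasoning
  distrib : ∀ a s p t → 1 + a * (s + p * t) ≡ 1 + a * s + a * p * t
  distrib = solve-∀

geomSum-* : ∀ a m n → geomSum a (m * n) ≡ geomSum a n * geomSum (a ^ n) m
geomSum-* a zero    n = sym (*-zeroʳ (geomSum a n))
geomSum-* a (suc m) n = begin
  geomSum a (n + m * n)                                     ≡⟨ geomSum-+ a n (m * n) ⟩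
  geomSum a n + a ^ n * geomSum a (m * n)                   ≡⟨ cong (λ s → geomSum a n + a ^ n * s) (geomSum-* a m n) ⟩
  geomSum a n + a ^ n * (geomSum a n * geomSum (a ^ n) m)   ≡⟨ factor (geomSum a n) (a ^ n) (geomSum (a ^ n) m) ⟩
  geomSum a n * (1 + a ^ n * geomSum (a ^ n) m)             ∎
  where
  open ≡-Reasoning
  factor : ∀ s p t → s + p * (s * t) ≡ s * (1 + p * t)
  factor = solve-∀

^≡1+*geomSum : ∀ c n → suc c ^ n ≡ 1 + c * geomSum (suc c) n
^≡1+*geomSum c zero    = cong suc (sym (*-zeroʳ c))
^≡1+*geomSum c (suc n) = trans (cong (suc c *_) (^≡1+*geomSum c n)) (telescope c (geomSum (suc c) n))
  where
  telescope : ∀ c s → (1 + c) * (1 + c * s) ≡ 1 + c * (1 + (1 + c) * s)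
  telescope = solve-∀

-- (1 + c)^j ≡ 1 + j c (mod c²), summed over j < n
geomSum-expansion : ∀ c n → ∃[ w ] geomSum (suc c) n ≡ n + c * triangular n + c * c * w
geomSum-expansion c zero    = 0 , expand₀ c
  where
  expand₀ : ∀ c → 0 ≡ 0 + c * 0 + c * c * 0
  expand₀ = solve-∀
geomSum-expansion c (suc n) with geomSum-expansion c n
... | w , eq = w + triangular n + c * w , trans (cong (λ s → 1 + suc c * s) eq) (expand c n (triangular n) w)
  where
  expand : ∀ c n t w → 1 + (1 + c) * (n + c * t + c * c * w) ≡ suc n + c * (t + n) + c * c * (w + t + c * w)
  expand = solve-∀

triangular-double : ∀ n → n + triangular n * 2 ≡ n * n
triangular-double zero    = refl
triangular-double (suc n) = begin
  suc n + (triangular n + n) * 2      ≡⟨ regroup (triangular n) n ⟩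
  (n + triangular n * 2) + 2 * n + 1  ≡⟨ cong (λ s → s + 2 * n + 1) (triangular-double n) ⟩
  n * n + 2 * n + 1                   ≡⟨ square n ⟩
  suc n * suc n                       ∎
  where
  open ≡-Reasoning
  regroup : ∀ t n → suc n + (t + n) * 2 ≡ (n + t * 2) + 2 * n + 1
  regroup = solve-∀
  square : ∀ n → n * n + 2 * n + 1 ≡ suc n * suc n
  square = solve-∀

-- Primes, coprimality and the radical

prime∣prime⇒≡ : Prime p → Prime q → p ∣ q → p ≡ q
prime∣prime⇒≡ p-prime q-prime p∣q with prime⇒irreducible q-prime p∣q
... | inj₁ refl = ⊥-elim (¬prime[1] p-prime)
... | inj₂ p≡q  = p≡q

2∣n⊎2∣1+n : ∀ n → 2 ∣ n ⊎ 2 ∣ suc n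
2∣n⊎2∣1+n zero    = inj₁ (divides 0 refl)
2∣n⊎2∣1+n (suc n) with 2∣n⊎2∣1+n n
... | inj₁ (divides h refl) = inj₂ (divides (suc h) refl)
... | inj₂ 2∣1+n           = inj₁ 2∣1+n

2∤1 : ¬ 2 ∣ 1
2∤1 2∣1 with ∣1⇒≡1 2∣1
... | ()

prime∤⇒coprime : Prime p → ¬ p ∣ n → Coprime p n
prime∤⇒coprime p-prime p∤n (d∣p , d∣n) with prime⇒irreducible p-prime d∣p
... | inj₁ d≡1 = d≡1
... | inj₂ refl = ⊥-elim (p∤n d∣n)

∃primeFactor : 2 ≤ n → ∃[ p ] Prime p × p ∣ n
∃primeFactor {n} 2≤n with factorise n {{>-nonZero (<-trans z<s 2≤n)}}
... | record { factors = [] ; isFactorisation = n≡1 } = ⊥-elim (<-irrefl (sym n≡1) 2≤n)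
... | record { factors = p ∷ ps ; isFactorisation = n≡p*ps ; factorsPrime = p-prime ∷ _ } =
  p , p-prime , subst (p ∣_) (sym n≡p*ps) (m∣m*n (product ps))

coprime-byPrimes : .{{NonZero m}} → (∀ {p} → Prime p → p ∣ m → ¬ p ∣ n) → Coprime m n
coprime-byPrimes {m} _ {0} (0∣m , _) = contradiction (0∣⇒≡0 0∣m) (≢-nonZero⁻¹ m)
coprime-byPrimes _ {1} _ = refl
coprime-byPrimes no-common {d@(suc (suc _))} (d∣m , d∣n) with ∃primeFactor {d} (s≤s (s≤s z≤n))
... | p , p-prime , p∣d = ⊥-elim (no-common p-prime (∣-trans p∣d d∣m) (∣-trans p∣d d∣n))

divisor-∣geomSum⇔∣ : p ∣ c → ∀ n → p ∣ geomSum (suc c) n ⇔ p ∣ n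
divisor-∣geomSum⇔∣ {p} {c} p∣c n = mk⇔
  (λ p∣S → ∣m+n∣m⇒∣n (subst (p ∣_) S≡ p∣S) p∣rest)
  (λ p∣n → subst (p ∣_) (sym S≡) (∣m∣n⇒∣m+n p∣rest p∣n))
  where
  w rest : ℕ
  w = proj₁ (geomSum-expansion c n)
  rest = c * (triangular n + c * w)
  regroup : ∀ n c t w → n + c * t + c * c * w ≡ c * (t + c * w) + n
  regroup = solve-∀
  S≡ : geomSum (suc c) n ≡ rest + n
  S≡ = trans (proj₂ (geomSum-expansion c n)) (regroup n c (triangular n) w)
  p∣rest : p ∣ rest
  p∣rest = ∣m⇒∣m*n _ p∣c

-- q ∣ triangular q for odd primes q, since 2 · triangular q = q (q − 1)
q²∣c*triangular : Prime q → q ∣ c → (q ≡ 2 → 4 ∣ c) → q * q ∣ c * triangular q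
q²∣c*triangular {q} q-prime q∣c 2⇒4∣c with q ≟ 2
... | yes refl = ∣m⇒∣m*n 1 (2⇒4∣c refl)
... | no q≢2   = *-pres-∣ q∣c q∣triangular
  where
  q∣2*triangular : q ∣ triangular q * 2
  q∣2*triangular = ∣m+n∣m⇒∣n (subst (q ∣_) (sym (triangular-double q)) (m∣m*n q)) ∣-refl
  q∣triangular : q ∣ triangular q
  q∣triangular with euclidsLemma (triangular q) 2 q-prime q∣2*triangular
  ... | inj₁ q∣t = q∣t
  ... | inj₂ q∣2 = ⊥-elim (q≢2 (prime∣prime⇒≡ q-prime prime[2] q∣2))

q²∤geomSum : Prime q → q ∣ c → (q ≡ 2 → 4 ∣ c) → ¬ q * q ∣ geomSum (suc c) q
q²∤geomSum {q} {c} q-prime q∣c 2⇒4∣c q²∣S = <⇒≱ q<q² (∣⇒≤ q²∣q)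
  where
  instance _ = prime⇒nonZero q-prime
  w : ℕ
  w = proj₁ (geomSum-expansion c q)
  q<q² : q < q * q
  q<q² = m<m*n q q (nonTrivial⇒n>1 q {{prime⇒nonTrivial q-prime}})
  q²∣q : q * q ∣ q
  q²∣q = ∣m+n∣m⇒∣n (∣m+n∣m⇒∣n (subst (q * q ∣_) S≡ q²∣S) (∣m⇒∣m*n w (*-pres-∣ q∣c q∣c)))
                   (q²∣c*triangular q-prime q∣c 2⇒4∣c)
    where
    regroup : ∀ q c t w → q + c * t + c * c * w ≡ c * c * w + (c * t + q)
    regroup = solve-∀
    S≡ = trans (proj₂ (geomSum-expansion c q)) (regroup q c (triangular q) w)

coprime-*ˡ : ∀ {x y m} → Coprime x m → Coprime y m → Coprime (x * y) m
coprime-*ˡ {x} {y} x⊥m y⊥m (k∣xy , k∣m) =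
  y⊥m (coprime-divisor (λ (j∣k , j∣x) → x⊥m (j∣x , ∣-trans j∣k k∣m)) k∣xy , k∣m)

ΠFin-coprime : ∀ {m} n {f : Fin n → ℕ} → (∀ i → Coprime (f i) m) → Coprime (ΠFin n f) m
ΠFin-coprime zero    _    (k∣1 , _) = ∣1⇒≡1 k∣1
ΠFin-coprime (suc n) f⊥m = coprime-*ˡ (f⊥m Fin.zero) (ΠFin-coprime n (f⊥m ∘ Fin.suc))

record RadicalDivides (m c : ℕ) : Set where
  field
    primes∣ : Prime p → p ∣ m → p ∣ c
    4∣     : 4 ∣ m → 4 ∣ c

open RadicalDivides

RadicalDivides-cofactor : RadicalDivides (q * m) c → RadicalDivides m c
RadicalDivides-cofactor {q} radDiv = record
  { primes∣ = λ p-prime p∣m → primes∣ radDiv p-prime (∣n⇒∣m*n q p∣m)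
  ; 4∣     = λ 4∣m → 4∣ radDiv (∣n⇒∣m*n q 4∣m)
  }

RadicalDivides-multiple : c ∣ n → RadicalDivides m c → RadicalDivides m n
RadicalDivides-multiple c∣n radDiv = record
  { primes∣ = λ p-prime p∣m → ∣-trans (primes∣ radDiv p-prime p∣m) c∣n
  ; 4∣     = λ 4∣m → ∣-trans (4∣ radDiv 4∣m) c∣n
  }

-- peels off one prime q of m at a time: writing S_A = geomSum A and A = 1 + c,
-- S_A(t q) = S_A(q) · S_{A^q}(t), where S_A(q) = q R with gcd(R, m / q) = 1
radical-∣geomSum⇔∣ : .{{NonZero m}} → RadicalDivides m c → ∀ n → m ∣ geomSum (suc c) n ⇔ m ∣ n
radical-∣geomSum⇔∣ {m} radDiv n with factorise m
... | record { factors = qs ; isFactorisation = refl ; factorsPrime = qs-prime } =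
  product-∣⇔ qs-prime radDiv n
  where
  product-∣⇔ : ∀ {qs} → All Prime qs → ∀ {c} → RadicalDivides (product qs) c →
               ∀ n → product qs ∣ geomSum (suc c) n ⇔ product qs ∣ n
  product-∣⇔ [] _ n = mk⇔ (λ _ → 1∣ n) (λ _ → 1∣ _)
  product-∣⇔ {q ∷ qs} (q-prime ∷ qs-prime) {c} radDiv n = mk⇔ ⇒ ⇐
    where
    instance
      _ = prime⇒nonZero q-prime
      _ = productOfPrimes≢0 qs-prime
    m′ R c′ : ℕ
    m′ = product qs
    q∣c : q ∣ c
    q∣c = primes∣ radDiv q-prime (m∣m*n m′)
    q∣S[q] : q ∣ geomSum (suc c) q
    q∣S[q] = from (divisor-∣geomSum⇔∣ q∣c q) ∣-refl
    R = quotient q∣S[q]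
    S[q]≡ : geomSum (suc c) q ≡ q * R
    S[q]≡ = trans (m∣n⇒n≡quotient*m q∣S[q]) (*-comm R q)
    c′ = c * geomSum (suc c) q
    radDiv′ : RadicalDivides m′ c′
    radDiv′ = RadicalDivides-multiple (m∣m*n _) (RadicalDivides-cofactor {q} radDiv)
    m′⊥R : Coprime m′ R
    m′⊥R = coprime-byPrimes λ {p} p-prime p∣m′ p∣R → case p-prime p∣m′ p∣R (p ≟ q)
      where
      p∣S : ∀ {p} → p ∣ R → p ∣ geomSum (suc c) q
      p∣S p∣R = subst (_ ∣_) (sym S[q]≡) (∣n⇒∣m*n q p∣R)
      case : ∀ {p} → Prime p → p ∣ m′ → p ∣ R → Dec (p ≡ q) → ⊥
      case p-prime p∣m′ p∣R (yes refl) = q²∤geomSum q-prime q∣c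
        (λ { refl → 4∣ radDiv (*-monoʳ-∣ 2 p∣m′) })
        (subst (_ ∣_) (sym S[q]≡) (*-monoʳ-∣ q p∣R))
      case p-prime p∣m′ p∣R (no p≢q) = p≢q (prime∣prime⇒≡ p-prime q-prime
        (to (divisor-∣geomSum⇔∣ (primes∣ radDiv p-prime (∣n⇒∣m*n q p∣m′)) q) (p∣S p∣R)))
    S[tq]≡ : ∀ t → geomSum (suc c) (t * q) ≡ q * (R * geomSum (suc c′) t)
    S[tq]≡ t = begin
      geomSum (suc c) (t * q)                  ≡⟨ geomSum-* (suc c) t q ⟩
      geomSum (suc c) q * geomSum (suc c ^ q) t    ≡⟨ cong₂ (λ s a → s * geomSum a t) S[q]≡ (^≡1+*geomSum c q) ⟩
      q * R * geomSum (suc c′) t         ≡⟨ *-assoc q R _ ⟩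
      q * (R * geomSum (suc c′) t)       ∎
      where open ≡-Reasoning
    multiple-of-q : ∀ t → q * m′ ∣ geomSum (suc c) (t * q) ⇔ m′ ∣ t
    multiple-of-q t = mk⇔
      (λ qm′∣S → to (product-∣⇔ qs-prime radDiv′ t)
        (coprime-divisor m′⊥R (*-cancelˡ-∣ q (subst (_ ∣_) (S[tq]≡ t) qm′∣S))))
      (λ m′∣t → subst (_ ∣_) (sym (S[tq]≡ t))
        (*-monoʳ-∣ q (∣n⇒∣m*n R (from (product-∣⇔ qs-prime radDiv′ t) m′∣t))))
    ⇒ : q * m′ ∣ geomSum (suc c) n → q * m′ ∣ n
    ⇒ qm′∣S with to (divisor-∣geomSum⇔∣ q∣c n) (∣-trans (m∣m*n m′) qm′∣S)
    ... | divides t refl = subst (_∣ t * q) (*-comm m′ q)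
                             (*-monoˡ-∣ q (to (multiple-of-q t) qm′∣S))
    ⇐ : q * m′ ∣ n → q * m′ ∣ geomSum (suc c) n
    ⇐ (divides k refl) = subst (λ n → q * m′ ∣ geomSum (suc c) n) (regroup k m′ q)
                           (from (multiple-of-q (k * m′)) (n∣m*n k))
      where
      regroup : ∀ k m′ q → k * m′ * q ≡ k * (q * m′)
      regroup = solve-∀

product-distinctPrimes-∣ : ∀ {ps} → Unique ps → All Prime ps → All (_∣ n) ps → product ps ∣ n
product-distinctPrimes-∣ {n} [] [] [] = 1∣ n
product-distinctPrimes-∣ {ps = p ∷ ps} (p∉ps ∷ ps-unique) (p-prime ∷ ps-prime) (p∣n ∷ ps∣n)
  with product-distinctPrimes-∣ ps-unique ps-prime ps∣n
... | divides t refl = *-monoˡ-∣ (product ps) p∣t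
  where
  p∤ps : ¬ p ∣ product ps
  p∤ps p∣ps = All.lookup p∉ps (factorisationHasAllPrimeFactors p-prime p∣ps ps-prime) refl
  p∣t : p ∣ t
  p∣t = coprime-divisor (prime∤⇒coprime p-prime p∤ps) (subst (p ∣_) (*-comm t (product ps)) p∣n)

private
  radicalFactor? : ∀ m p → Dec (Prime p × p ∣ m)
  radicalFactor? m p = prime? p ×-dec (p ∣? m)

prime∣⇒∣rad : .{{NonZero m}} → Prime p → p ∣ m → p ∣ rad m
prime∣⇒∣rad {m} p-prime p∣m =
  ∈⇒∣product (∈-filter⁺ (radicalFactor? m) (∈-upTo⁺ (s≤s (∣⇒≤ p∣m))) (p-prime , p∣m))

rad∣ : (∀ {p} → Prime p → p ∣ m → p ∣ n) → rad m ∣ n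
rad∣ {m} primes∣n = product-distinctPrimes-∣
  (filter⁺ (radicalFactor? m) (upTo⁺ (suc m)))
  (All.map proj₁ radicalFactors)
  (All.map (λ (p-prime , p∣m) → primes∣n p-prime p∣m) radicalFactors)
  where
  radicalFactors : All (λ p → Prime p × p ∣ m) (filter (radicalFactor? m) (upTo (suc m)))
  radicalFactors = all-filter (radicalFactor? m) (upTo (suc m))

rad′∣⇔RadicalDivides : .{{NonZero m}} → rad′ m ∣ c ⇔ RadicalDivides m c
rad′∣⇔RadicalDivides {m} {c} with 4 ∣? m
... | no 4∤m = mk⇔
  (λ rad∣c → record { primes∣ = λ p-prime p∣m → ∣-trans (prime∣⇒∣rad p-prime p∣m) rad∣c
                    ; 4∣ = λ 4∣m → ⊥-elim (4∤m 4∣m) })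
  (λ radDiv → rad∣ (RadicalDivides.primes∣ radDiv))
... | yes 4∣m = mk⇔
  (λ 2rad∣c → record
    { primes∣ = λ p-prime p∣m → ∣-trans (∣n⇒∣m*n 2 (prime∣⇒∣rad p-prime p∣m)) 2rad∣c
    ; 4∣ = λ _ → ∣-trans (*-monoʳ-∣ 2 (prime∣⇒∣rad prime[2] 2∣m)) 2rad∣c })
  2rad∣
  where
  2∣m : 2 ∣ m
  2∣m = ∣-trans (divides 2 refl) 4∣m
  2rad∣ : RadicalDivides m c → 2 * rad m ∣ c
  2rad∣ radDiv with RadicalDivides.primes∣ radDiv prime[2] 2∣m
  ... | divides h refl = subst (2 * rad m ∣_) (*-comm 2 h) (*-monoʳ-∣ 2 (rad∣ primes∣h))
    where
    primes∣h : ∀ {p} → Prime p → p ∣ m → p ∣ h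
    primes∣h {p} p-prime p∣m with p ≟ 2
    ... | yes refl = *-cancelʳ-∣ 2 (RadicalDivides.4∣ radDiv 4∣m)
    ... | no p≢2 with euclidsLemma h 2 p-prime (RadicalDivides.primes∣ radDiv p-prime p∣m)
    ...   | inj₁ p∣h = p∣h
    ...   | inj₂ p∣2 = ⊥-elim (p≢2 (prime∣prime⇒≡ p-prime prime[2] p∣2))

-- Affine maps of ℤ/mℤ

%-affine : ∀ a b x m .{{_ : NonZero m}} → (a * (x % m) + b) % m ≡ (a * x + b) % m
%-affine a b x m = begin
  (a * (x % m) + b) % m                 ≡⟨ %-distribˡ-+ (a * (x % m)) b m ⟩
  ((a * (x % m)) % m + b % m) % m       ≡⟨ cong (λ s → (s + b % m) % m) a[x%m]%m≡ax%m ⟩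
  ((a * x) % m + b % m) % m             ≡⟨ %-distribˡ-+ (a * x) b m ⟨
  (a * x + b) % m                       ∎
  where
  open ≡-Reasoning
  a[x%m]%m≡ax%m : (a * (x % m)) % m ≡ (a * x) % m
  a[x%m]%m≡ax%m = begin
    (a * (x % m)) % m          ≡⟨ %-distribˡ-* a (x % m) m ⟩
    (a % m * (x % m % m)) % m  ≡⟨ cong (λ s → (a % m * s) % m) (m%n%n≡m%n x m) ⟩
    (a % m * (x % m)) % m      ≡⟨ %-distribˡ-* a x m ⟨
    (a * x) % m                ∎

[x+y]%m≡x%m⇒m∣y : ∀ x y m .{{_ : NonZero m}} → (x + y) % m ≡ x % m → m ∣ y
[x+y]%m≡x%m⇒m∣y x y m eq = divides ((x + y) / m ∸ x / m) (sym (begin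
  ((x + y) / m ∸ x / m) * m                               ≡⟨ *-distribʳ-∸ m ((x + y) / m) (x / m) ⟩
  (x + y) / m * m ∸ x / m * m                             ≡⟨ [m+n]∸[m+o]≡n∸o (x % m) _ _ ⟨
  (x % m + (x + y) / m * m) ∸ (x % m + x / m * m)         ≡⟨ cong (λ r → (r + (x + y) / m * m) ∸ (x % m + x / m * m)) eq ⟨
  ((x + y) % m + (x + y) / m * m) ∸ (x % m + x / m * m)   ≡⟨ cong₂ _∸_ (m≡m%n+[m/n]*n (x + y) m) (m≡m%n+[m/n]*n x m) ⟨
  (x + y) ∸ x                                             ≡⟨ m+n∸m≡n x y ⟩
  y                                                       ∎))
  where open ≡-Reasoning

module _ {m : ℕ} .{{_ : NonZero m}} where

  toℕ-hol : ∀ a b x → toℕ (hol m a b x) ≡ (a * toℕ x + b) % m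
  toℕ-hol a b x = toℕ-fromℕ< _

  hol-%-divisor : ∀ {p} .{{_ : NonZero p}} → p ∣ m → ∀ a b x →
                  toℕ (hol m a b x) % p ≡ (a * (toℕ x % p) + b) % p
  hol-%-divisor {p} p∣m a b x = begin
    toℕ (hol m a b x) % p          ≡⟨ cong (_% p) (toℕ-hol a b x) ⟩
    (a * toℕ x + b) % m % p        ≡⟨ m∣n⇒o%n%m≡o%m p m _ p∣m ⟩
    (a * toℕ x + b) % p            ≡⟨ %-affine a b (toℕ x) p ⟨
    (a * (toℕ x % p) + b) % p      ∎
    where open ≡-Reasoning

  hol-identity : ∀ x → hol m 1 0 x ≡ x
  hol-identity x = toℕ-injective (begin
    toℕ (hol m 1 0 x)       ≡⟨ toℕ-hol 1 0 x ⟩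
    (1 * toℕ x + 0) % m     ≡⟨ cong (_% m) (trans (+-identityʳ _) (*-identityˡ _)) ⟩
    toℕ x % m               ≡⟨ m<n⇒m%n≡m (toℕ<n x) ⟩
    toℕ x                   ∎)
    where open ≡-Reasoning

  hol-∘ : ∀ a b a′ b′ x → hol m a′ b′ (hol m a b x) ≡ hol m (a′ * a) (a′ * b + b′) x
  hol-∘ a b a′ b′ x = toℕ-injective (begin
    toℕ (hol m a′ b′ (hol m a b x))         ≡⟨ toℕ-hol a′ b′ _ ⟩
    (a′ * toℕ (hol m a b x) + b′) % m       ≡⟨ cong (λ s → (a′ * s + b′) % m) (toℕ-hol a b x) ⟩
    (a′ * ((a * toℕ x + b) % m) + b′) % m   ≡⟨ %-affine a′ b′ _ m ⟩
    (a′ * (a * toℕ x + b) + b′) % m         ≡⟨ cong (_% m) (compose a′ a (toℕ x) b b′) ⟩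
    (a′ * a * toℕ x + (a′ * b + b′)) % m    ≡⟨ toℕ-hol (a′ * a) (a′ * b + b′) x ⟨
    toℕ (hol m (a′ * a) (a′ * b + b′) x)    ∎)
    where
    open ≡-Reasoning
    compose : ∀ a′ a x b b′ → a′ * (a * x + b) + b′ ≡ a′ * a * x + (a′ * b + b′)
    compose = solve-∀

  iter-hol : ∀ a b n x → iter (hol m a b) n x ≡ hol m (a ^ n) (b * geomSum a n) x
  iter-hol a b zero    x = trans (sym (hol-identity x)) (cong (λ s → hol m 1 s x) (sym (*-zeroʳ b)))
  iter-hol a b (suc n) x = begin
    hol m a b (iter (hol m a b) n x)                      ≡⟨ cong (hol m a b) (iter-hol a b n x) ⟩
    hol m a b (hol m (a ^ n) (b * geomSum a n) x)         ≡⟨ hol-∘ _ _ a b x ⟩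
    hol m (a * a ^ n) (a * (b * geomSum a n) + b) x       ≡⟨ cong (λ s → hol m (a * a ^ n) s x) (factor a b (geomSum a n)) ⟩
    hol m (a * a ^ n) (b * (1 + a * geomSum a n)) x       ∎
    where
    open ≡-Reasoning
    factor : ∀ a b s → a * (b * s) + b ≡ b * (1 + a * s)
    factor = solve-∀

  private
    hol-injective-≤ : ∀ {a} b → Coprime a m → ∀ {x y} → toℕ x ≤ toℕ y →
                      hol m a b x ≡ hol m a b y → toℕ x ≡ toℕ y
    hol-injective-≤ {a} b a⊥m {x} {y} x≤y eq =
      ≤-antisym x≤y (m∸n≡0⇒m≤n (trans (sym (m<n⇒m%n≡m gap<m)) (n∣m⇒m%n≡0 _ m m∣gap)))
      where
      gap : ℕ
      gap = toℕ y ∸ toℕ x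
      gap<m : gap < m
      gap<m = ≤-<-trans (m∸n≤m (toℕ y) (toℕ x)) (toℕ<n y)
      regroup : ∀ a x g b → a * (x + g) + b ≡ (a * x + b) + a * g
      regroup = solve-∀
      shift : a * toℕ y + b ≡ (a * toℕ x + b) + a * gap
      shift = trans (cong (λ s → a * s + b) (sym (m+[n∸m]≡n x≤y))) (regroup a (toℕ x) gap b)
      m∣gap : m ∣ gap
      m∣gap = coprime-divisor (Coprime.sym a⊥m) ([x+y]%m≡x%m⇒m∣y _ _ m (begin
        (a * toℕ x + b + a * gap) % m  ≡⟨ cong (_% m) shift ⟨
        (a * toℕ y + b) % m            ≡⟨ toℕ-hol a b y ⟨
        toℕ (hol m a b y)              ≡⟨ cong toℕ eq ⟨
        toℕ (hol m a b x)              ≡⟨ toℕ-hol a b x ⟩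
        (a * toℕ x + b) % m            ∎))
        where open ≡-Reasoning

  hol-injective : ∀ {a} b → Coprime a m → Injective _≡_ _≡_ (hol m a b)
  hol-injective b a⊥m {x} {y} eq with ≤-total (toℕ x) (toℕ y)
  ... | inj₁ x≤y = toℕ-injective (hol-injective-≤ b a⊥m x≤y eq)
  ... | inj₂ y≤x = toℕ-injective (sym (hol-injective-≤ b a⊥m y≤x (sym eq)))

-- The Hull–Dobell theorem

origin : ∀ {m} .{{_ : NonZero m}} → Fin m
origin {m} = fromℕ< (>-nonZero⁻¹ m)

module _ {m : ℕ} .{{_ : NonZero m}} where

  toℕ-iter-hol-origin : ∀ a b n → toℕ (iter (hol m a b) n origin) ≡ (b * geomSum a n) % m
  toℕ-iter-hol-origin a b n = begin
    toℕ (iter (hol m a b) n origin)                ≡⟨ cong toℕ (iter-hol a b n origin) ⟩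
    toℕ (hol m (a ^ n) (b * geomSum a n) origin)   ≡⟨ toℕ-hol (a ^ n) (b * geomSum a n) origin ⟩
    (a ^ n * toℕ origin + b * geomSum a n) % m     ≡⟨ cong (λ x → (a ^ n * x + b * geomSum a n) % m) (toℕ-fromℕ< _) ⟩
    (a ^ n * 0 + b * geomSum a n) % m              ≡⟨ cong (λ x → (x + b * geomSum a n) % m) (*-zeroʳ (a ^ n)) ⟩
    (b * geomSum a n) % m                          ∎
    where open ≡-Reasoning

  iter-hol-origin⇔ : ∀ a b n → iter (hol m a b) n origin ≡ origin ⇔ m ∣ b * geomSum a n
  iter-hol-origin⇔ a b n = mk⇔
    (λ eq → m%n≡0⇒n∣m _ m (trans (sym (toℕ-iter-hol-origin a b n)) (trans (cong toℕ eq) (toℕ-fromℕ< _))))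
    (λ m∣bS → toℕ-injective (trans (toℕ-iter-hol-origin a b n) (trans (n∣m⇒m%n≡0 _ m m∣bS) (sym (toℕ-fromℕ< _)))))

  hullDobell-sufficient : ∀ {c b} → Coprime (suc c) m → RadicalDivides m c → gcd m b ≡ 1 →
                          IsFullCycle (hol m (suc c) b)
  hullDobell-sufficient {c} {b} a⊥m radDiv gcd≡1 =
    exactPeriod⇒fullCycle (hol m (suc c) b) (hol-injective b a⊥m) origin λ n →
      ⇔-trans (iter-hol-origin⇔ (suc c) b n) (⇔-trans m∣bS⇔m∣S (radical-∣geomSum⇔∣ radDiv n))
    where
    m∣bS⇔m∣S : ∀ {s} → m ∣ b * s ⇔ m ∣ s
    m∣bS⇔m∣S = mk⇔ (coprime-divisor (gcd≡1⇒coprime gcd≡1)) (∣n⇒∣m*n b)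

  fullCycle⇒gcd≡1 : ∀ {a b} → 1 < m → IsFullCycle (hol m a b) → gcd m b ≡ 1
  fullCycle⇒gcd≡1 {a} {b} 1<m full with full origin (fromℕ< 1<m)
  ... | k , fᵏ0≡1 = ∣1⇒≡1 (subst (gcd m b ∣_) bS%m≡1
    (%-presˡ-∣ (∣m⇒∣m*n (geomSum a k) (gcd[m,n]∣n m b)) (gcd[m,n]∣m m b)))
    where
    bS%m≡1 : (b * geomSum a k) % m ≡ 1
    bS%m≡1 = trans (sym (toℕ-iter-hol-origin a b k)) (trans (cong toℕ fᵏ0≡1) (toℕ-fromℕ< 1<m))

  -- if p ∤ c then x ↦ (1 + c) x + b fixes a residue u mod p, so the orbit of u stays in its class
  fullCycle⇒primes∣ : ∀ {c b p} → 1 < m → IsFullCycle (hol m (suc c) b) → Prime p → p ∣ m → p ∣ c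
  fullCycle⇒primes∣ {c} {b} {p} 1<m full p-prime p∣m with p ∣? c
  ... | yes p∣c = p∣c
  ... | no p∤c = ⊥-elim (0≢1+n (trans (residue-fixed (>-nonZero⁻¹ p)) (sym (residue-fixed 1<p))))
    where
    instance _ = prime⇒nonZero p-prime
    1<p : 1 < p
    1<p = nonTrivial⇒n>1 p {{prime⇒nonTrivial p-prime}}
    root : ∃[ r ] hol p c b r ≡ origin
    root = injective⇒surjective (hol p c b) (hol-injective b (Coprime.sym (prime∤⇒coprime p-prime p∤c))) origin
    u : ℕ
    u = toℕ (proj₁ root)
    p∣cu+b : p ∣ c * u + b
    p∣cu+b = m%n≡0⇒n∣m _ p (trans (sym (toℕ-hol c b (proj₁ root))) (trans (cong toℕ (proj₂ root)) (toℕ-fromℕ< _)))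
    Residue-u : Fin m → Set
    Residue-u x = toℕ x % p ≡ u
    step : ∀ x → Residue-u x → Residue-u (hol m (suc c) b x)
    step x x≡u = begin
      toℕ (hol m (suc c) b x) % p        ≡⟨ hol-%-divisor p∣m (suc c) b x ⟩
      (suc c * (toℕ x % p) + b) % p      ≡⟨ cong (λ r → (suc c * r + b) % p) x≡u ⟩
      (u + c * u + b) % p                ≡⟨ cong (_% p) (+-assoc u (c * u) b) ⟩
      (u + (c * u + b)) % p              ≡⟨ %-remove-+ʳ u p∣cu+b ⟩
      u % p                              ≡⟨ m<n⇒m%n≡m (toℕ<n (proj₁ root)) ⟩
      u                                  ∎
      where open ≡-Reasoning
    u<m : u < m
    u<m = <-≤-trans (toℕ<n (proj₁ root)) (∣⇒≤ p∣m)
    start : Residue-u (fromℕ< u<m)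
    start = trans (cong (_% p) (toℕ-fromℕ< u<m)) (m<n⇒m%n≡m (toℕ<n (proj₁ root)))
    residue-fixed : ∀ {k} (k<p : k < p) → k ≡ u
    residue-fixed {k} k<p = trans (sym (trans (cong (_% p) (toℕ-fromℕ< k<m)) (m<n⇒m%n≡m k<p)))
      (fullCycle-invariant full Residue-u step start (fromℕ< k<m))
      where
      k<m : k < m
      k<m = <-≤-trans k<p (∣⇒≤ p∣m)

  -- if c ≡ 2 (mod 4) then x ↦ (1 + c) x + b swaps the classes 0 and b mod 4, so it misses 2
  fullCycle⇒4∣ : ∀ {c b} → 1 < m → IsFullCycle (hol m (suc c) b) → 4 ∣ m → 4 ∣ c
  fullCycle⇒4∣ {c} {b} 1<m full 4∣m = decidable-stable (4 ∣? c) λ 4∤c →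
    ¬Class[2] (fullCycle-invariant full Class (step 4∤c) {origin} start (fromℕ< 2<m))
    where
    2<m : 2 < m
    2<m = <-≤-trans (s≤s (s≤s z<s)) (∣⇒≤ 4∣m)
    4∣c+2 : ¬ 4 ∣ c → 4 ∣ 2 + c
    4∣c+2 4∤c with fullCycle⇒primes∣ {c = c} 1<m full prime[2] (∣-trans (divides 2 refl) 4∣m)
    ... | divides h c≡h*2 with 2∣n⊎2∣1+n h
    ...   | inj₁ 2∣h   = ⊥-elim (4∤c (subst (4 ∣_) (sym c≡h*2) (*-monoˡ-∣ 2 2∣h)))
    ...   | inj₂ 2∣1+h = subst (λ c → 4 ∣ 2 + c) (sym c≡h*2) (*-monoˡ-∣ 2 2∣1+h)
    Class : Fin m → Set
    Class x = toℕ x % 4 ≡ 0 ⊎ toℕ x % 4 ≡ b % 4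
    step : ¬ 4 ∣ c → ∀ x → Class x → Class (hol m (suc c) b x)
    step _ x (inj₁ x≡0) = inj₂ (begin
      toℕ (hol m (suc c) b x) % 4     ≡⟨ hol-%-divisor 4∣m (suc c) b x ⟩
      (suc c * (toℕ x % 4) + b) % 4   ≡⟨ cong (λ r → (suc c * r + b) % 4) x≡0 ⟩
      (suc c * 0 + b) % 4             ≡⟨ cong (λ r → (r + b) % 4) (*-zeroʳ (suc c)) ⟩
      b % 4                           ∎)
      where open ≡-Reasoning
    step 4∤c x (inj₂ x≡b) = inj₁ (begin
      toℕ (hol m (suc c) b x) % 4     ≡⟨ hol-%-divisor 4∣m (suc c) b x ⟩
      (suc c * (toℕ x % 4) + b) % 4   ≡⟨ cong (λ r → (suc c * r + b) % 4) x≡b ⟩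
      (suc c * (b % 4) + b) % 4       ≡⟨ %-affine (suc c) b b 4 ⟩
      (suc c * b + b) % 4             ≡⟨ cong (_% 4) (+-comm (suc c * b) b) ⟩
      (2 + c) * b % 4                 ≡⟨ n∣m⇒m%n≡0 _ 4 (∣m⇒∣m*n b (4∣c+2 4∤c)) ⟩
      0                               ∎)
      where open ≡-Reasoning
    start : Class origin
    start = inj₁ (cong (_% 4) (toℕ-fromℕ< (>-nonZero⁻¹ m)))
    ¬Class[2] : ¬ Class (fromℕ< 2<m)
    ¬Class[2] (inj₁ 2≡0) = 0≢1+n (sym (trans (sym (cong (_% 4) (toℕ-fromℕ< 2<m))) 2≡0))
    ¬Class[2] (inj₂ 2≡b) = 2∤1 (subst (2 ∣_) (fullCycle⇒gcd≡1 {a = suc c} 1<m full)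
      (gcd-greatest (∣-trans (divides 2 refl) 4∣m) 2∣b))
      where
      2∣b : 2 ∣ b
      2∣b = ∣n∣m%n⇒∣m (divides 2 refl) (subst (2 ∣_) (trans (sym (cong (_% 4) (toℕ-fromℕ< 2<m))) 2≡b) ∣-refl)

hullDobell : ∀ {m} .{{_ : NonZero m}} {a} b → Coprime a m →
             IsFullCycle (hol m a b) ⇔ ((+ rad′ m) ℤ.∣ (+ a - + 1) × gcd m b ≡ 1)
hullDobell {1} b _ = mk⇔ (λ _ → 1∣ _ , gcd-zeroˡ b) (λ _ → λ { Fin.zero Fin.zero → 0 , refl })
hullDobell {suc (suc m)} {zero} b 0⊥m with 0⊥m ((suc (suc m)) ∣0 , ∣-refl)
... | ()
hullDobell {m@(suc (suc _))} {suc c} b a⊥m = mk⇔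
  (λ full → from rad′∣⇔RadicalDivides (record
              { primes∣ = fullCycle⇒primes∣ {c = c} 1<m full ; 4∣ = fullCycle⇒4∣ {c = c} 1<m full })
          , fullCycle⇒gcd≡1 {a = suc c} 1<m full)
  (λ (rad′∣c , gcd≡1) → hullDobell-sufficient a⊥m (to rad′∣⇔RadicalDivides rad′∣c) gcd≡1)
  where
  1<m : 1 < m
  1<m = s≤s (s≤s z≤n)

-- Skew products over a permutation

⟨$⟩ʳ-injective : ∀ {d} (π : Permutation′ d) → Injective _≡_ _≡_ (π ⟨$⟩ʳ_)
⟨$⟩ʳ-injective π = Injection.injective (↔⇒↣ π)

module _ {d : ℕ} {X : Set} (ψ : Permutation′ d) (h : Fin d → X → X) where

  skew : X × Fin d → X × Fin d
  skew (x , i) = h (ψ ⟨$⟩ʳ i) x , ψ ⟨$⟩ʳ i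

  proj₂-iter-skew : ∀ n p → proj₂ (iter skew n p) ≡ iter (ψ ⟨$⟩ʳ_) n (proj₂ p)
  proj₂-iter-skew zero    p = refl
  proj₂-iter-skew (suc n) p = cong (ψ ⟨$⟩ʳ_) (proj₂-iter-skew n p)

  module _ (o : Fin d) where

    transport : ℕ → X → X
    transport n x = proj₁ (iter skew n (x , o))

    iter-skew-fibre : ∀ n x → iter skew n (x , o) ≡ (transport n x , iter (ψ ⟨$⟩ʳ_) n o)
    iter-skew-fibre n x = cong (transport n x ,_) (proj₂-iter-skew n (x , o))

    transport-suc : ∀ n x → transport (suc n) x ≡ h (iter (ψ ⟨$⟩ʳ_) (suc n) o) (transport n x)
    transport-suc n x = cong (λ p → proj₁ (skew p)) (iter-skew-fibre n x)

    transport-surjective : (∀ i y → ∃[ x ] h i x ≡ y) → ∀ n y → ∃[ x ] transport n x ≡ y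
    transport-surjective h-surj zero    y = y , refl
    transport-surjective h-surj (suc n) y with h-surj (iter (ψ ⟨$⟩ʳ_) (suc n) o) y
    ... | y′ , hy′≡y with transport-surjective h-surj n y′
    ...   | x , tx≡y′ = x , trans (transport-suc n x) (trans (cong (h _) tx≡y′) hy′≡y)

    module _ .{{_ : NonZero d}} (ψ-full : IsFullCycle (ψ ⟨$⟩ʳ_)) where

      iter-skew-return : ∀ q x → iter skew (q * d) (x , o) ≡ (iter (transport d) q x , o)
      iter-skew-return zero    x = refl
      iter-skew-return (suc q) x = begin
        iter skew (d + q * d) (x , o)                          ≡⟨ iter-+ skew d (q * d) (x , o) ⟩
        iter skew d (iter skew (q * d) (x , o))                ≡⟨ cong (iter skew d) (iter-skew-return q x) ⟩
        iter skew d (iter (transport d) q x , o)               ≡⟨ iter-skew-fibre d _ ⟩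
        (iter (transport d) (suc q) x , iter (ψ ⟨$⟩ʳ_) d o)    ≡⟨ cong (iter (transport d) (suc q) x ,_)
                                                                     (fullCycle⇒returns _ (⟨$⟩ʳ-injective ψ) o ψ-full) ⟩
        (iter (transport d) (suc q) x , o)                     ∎
        where open ≡-Reasoning

    -- the point of X is needed: over empty fibres every skew product is vacuously a full cycle
    skew-fullCycle⇔ : .{{_ : NonZero d}} → X → (∀ i y → ∃[ x ] h i x ≡ y) →
                      IsFullCycle skew ⇔ (IsFullCycle (ψ ⟨$⟩ʳ_) × IsFullCycle (transport d))
    skew-fullCycle⇔ x₀ h-surj = mk⇔ ⇒ ⇐
      where
      ⇒ : IsFullCycle skew → IsFullCycle (ψ ⟨$⟩ʳ_) × IsFullCycle (transport d)
      ⇒ full = ψ-full , return-full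
        where
        ψ-full : IsFullCycle (ψ ⟨$⟩ʳ_)
        ψ-full i j with full (x₀ , i) (x₀ , j)
        ... | n , eq = n , trans (sym (proj₂-iter-skew n (x₀ , i))) (cong proj₂ eq)
        return-full : IsFullCycle (transport d)
        return-full x y with full (x , o) (y , o)
        ... | n , eq with to (fullCycle⇒exactPeriod _ (⟨$⟩ʳ-injective ψ) o ψ-full n)
                             (trans (sym (proj₂-iter-skew n (x , o))) (cong proj₂ eq))
        ...   | divides q refl = q , cong proj₁ (trans (sym (iter-skew-return ψ-full q x)) eq)
      ⇐ : IsFullCycle (ψ ⟨$⟩ʳ_) × IsFullCycle (transport d) → IsFullCycle skew
      ⇐ (ψ-full , return-full) (x , i) (y , j) = t + (k * d + s) , (begin
        iter skew (t + (k * d + s)) (x , i)               ≡⟨ iter-+ skew t _ _ ⟩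
        iter skew t (iter skew (k * d + s) (x , i))       ≡⟨ cong (iter skew t) (iter-+ skew (k * d) s _) ⟩
        iter skew t (iter skew (k * d) (iter skew s (x , i)))  ≡⟨ cong (iter skew t ∘ iter skew (k * d)) to-fibre ⟩
        iter skew t (iter skew (k * d) (x′ , o))          ≡⟨ cong (iter skew t) (iter-skew-return ψ-full k x′) ⟩
        iter skew t (iter (transport d) k x′ , o)         ≡⟨ cong (λ z → iter skew t (z , o)) returnᵏx′≡y′ ⟩
        iter skew t (y′ , o)                              ≡⟨ iter-skew-fibre t y′ ⟩
        (transport t y′ , iter (ψ ⟨$⟩ʳ_) t o)             ≡⟨ cong₂ _,_ transportᵗy′≡y ψᵗo≡j ⟩
        (y , j)                                           ∎)
        where
        open ≡-Reasoning
        s t k : ℕ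
        s = proj₁ (ψ-full i o)
        x′ y′ : X
        x′ = proj₁ (iter skew s (x , i))
        to-fibre : iter skew s (x , i) ≡ (x′ , o)
        to-fibre = cong (x′ ,_) (trans (proj₂-iter-skew s (x , i)) (proj₂ (ψ-full i o)))
        t = proj₁ (ψ-full o j)
        ψᵗo≡j : iter (ψ ⟨$⟩ʳ_) t o ≡ j
        ψᵗo≡j = proj₂ (ψ-full o j)
        y′ = proj₁ (transport-surjective h-surj t y)
        transportᵗy′≡y : transport t y′ ≡ y
        transportᵗy′≡y = proj₂ (transport-surjective h-surj t y)
        k = proj₁ (return-full x′ y′)
        returnᵏx′≡y′ : iter (transport d) k x′ ≡ y′
        returnᵏx′≡y′ = proj₂ (return-full x′ y′)

  skew-involutive⇔ : X →
    (∀ p → skew (skew p) ≡ p) ⇔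
    ((∀ i → ψ ⟨$⟩ʳ (ψ ⟨$⟩ʳ i) ≡ i)
     × (∀ i → ψ ⟨$⟩ʳ i ≢ i → ∀ x → h (ψ ⟨$⟩ʳ i) (h i x) ≡ x)
     × (∀ i → ψ ⟨$⟩ʳ i ≡ i → ∀ x → h i (h i x) ≡ x))
  skew-involutive⇔ x₀ = mk⇔ ⇒ ⇐
    where
    Conditions : Set
    Conditions = (∀ i → ψ ⟨$⟩ʳ (ψ ⟨$⟩ʳ i) ≡ i)
               × (∀ i → ψ ⟨$⟩ʳ i ≢ i → ∀ x → h (ψ ⟨$⟩ʳ i) (h i x) ≡ x)
               × (∀ i → ψ ⟨$⟩ʳ i ≡ i → ∀ x → h i (h i x) ≡ x)
    ⇒ : (∀ p → skew (skew p) ≡ p) → Conditions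
    ⇒ skew² = ψ² , (λ i _ → h-inverse i) , λ i ψi≡i x → subst (λ j → h j (h i x) ≡ x) ψi≡i (h-inverse i x)
      where
      ψ² : ∀ i → ψ ⟨$⟩ʳ (ψ ⟨$⟩ʳ i) ≡ i
      ψ² i = cong proj₂ (skew² (x₀ , i))
      h-inverse : ∀ i x → h (ψ ⟨$⟩ʳ i) (h i x) ≡ x
      h-inverse i x = subst (λ j → h (ψ ⟨$⟩ʳ j) (h j x) ≡ x) (ψ² i) (cong proj₁ (skew² (x , ψ ⟨$⟩ʳ i)))
    ⇐ : Conditions → ∀ p → skew (skew p) ≡ p
    ⇐ (ψ² , moved , fixed) (x , i) = cong₂ _,_ (h-inverse (ψ ⟨$⟩ʳ i) x) (ψ² i)
      where
      h-inverse : ∀ j x → h (ψ ⟨$⟩ʳ j) (h j x) ≡ x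
      h-inverse j x with ψ ⟨$⟩ʳ j Fin.≟ j
      ... | yes ψj≡j = subst (λ k → h k (h j x) ≡ x) (sym ψj≡j) (fixed j ψj≡j x)
      ... | no  ψj≢j = moved j ψj≢j x

-- The wreath product W(d, m)

⇔-×ʳ-trans : {P Q R S : Set} → P ⇔ (Q × R) → (Q → R ⇔ S) → P ⇔ (Q × S)
⇔-×ʳ-trans P⇔Q×R R⇔S = mk⇔
  (λ p → let q , r = to P⇔Q×R p in q , to (R⇔S q) r)
  (λ (q , s) → from P⇔Q×R (q , from (R⇔S q) s))

ΠFin≡sum : ∀ n (f : Fin n → ℕ) → ΠFin n f ≡ sum f
ΠFin≡sum zero    f = refl
ΠFin≡sum (suc n) f = cong (f Fin.zero *_) (ΠFin≡sum n (f ∘ Fin.suc))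

prodFrom-snoc : ∀ lo n f → prodFrom lo (suc n) f ≡ prodFrom lo n f * f (lo + n)
prodFrom-snoc lo zero    f = begin
  f lo * 1        ≡⟨ *-comm (f lo) 1 ⟩
  1 * f lo        ≡⟨ cong (λ k → 1 * f k) (+-identityʳ lo) ⟨
  1 * f (lo + 0)  ∎
  where open ≡-Reasoning
prodFrom-snoc lo (suc n) f = begin
  f lo * prodFrom (suc lo) (suc n) f              ≡⟨ cong (f lo *_) (prodFrom-snoc (suc lo) n f) ⟩
  f lo * (prodFrom (suc lo) n f * f (suc lo + n)) ≡⟨ *-assoc (f lo) _ _ ⟨
  f lo * prodFrom (suc lo) n f * f (suc lo + n)   ≡⟨ cong (λ k → f lo * prodFrom (suc lo) n f * f k) (+-suc lo n) ⟨
  f lo * prodFrom (suc lo) n f * f (lo + suc n)   ∎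
  where open ≡-Reasoning

sumTo-cong : ∀ n {F G : ℕ → ℕ} → (∀ {j} → j < n → F j ≡ G j) → sumTo n F ≡ sumTo n G
sumTo-cong zero    F≡G = refl
sumTo-cong (suc n) F≡G = cong₂ _+_ (sumTo-cong n (F≡G ∘ m<n⇒m<1+n)) (F≡G ≤-refl)

sumTo-*ˡ : ∀ n c F → sumTo n (λ j → c * F j) ≡ c * sumTo n F
sumTo-*ˡ zero    c F = sym (*-zeroʳ c)
sumTo-*ˡ (suc n) c F = trans (cong (_+ c * F n) (sumTo-*ˡ n c F)) (sym (*-distribˡ-+ c (sumTo n F) (F n)))

module _ {d m : ℕ} .{{_ : NonZero d}} .{{_ : NonZero m}} (ψ : Permutation′ d) (a b : Fin d → ℕ) where

  private
    g : Fin d → Fin m → Fin m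
    g i = hol m (a i) (b i)
    o : Fin d
    o = fin0 d
    ix : ℕ → Fin d
    ix = idx d m ψ a b
    α β : ℕ → ℕ
    α = a ∘ ix
    β = b ∘ ix

  linearPart : ℕ → ℕ
  linearPart zero    = 1
  linearPart (suc n) = α n * linearPart n

  translationPart : ℕ → ℕ
  translationPart zero    = 0
  translationPart (suc n) = α n * translationPart n + β n

  cycAct≡hol : ∀ n x → cycAct d m ψ a b n x ≡ hol m (linearPart n) (translationPart n) x
  cycAct≡hol zero    x = sym (hol-identity x)
  cycAct≡hol (suc n) x = trans (cong (g (ix n)) (cycAct≡hol n x)) (hol-∘ _ _ (α n) (β n) x)

  transport-cycAct : ∀ n x → transport ψ g o n (g o x) ≡ g (ix n) (cycAct d m ψ a b n x)
  transport-cycAct zero    x = refl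
  transport-cycAct (suc n) x =
    trans (transport-suc ψ g o n (g o x)) (cong (g (ix (suc n))) (transport-cycAct n x))

  wAct-fullCycle⇔ : (∀ i → Coprime (a i) m) →
    IsFullCycle (wAct d m ψ a b) ⇔ (IsFullCycle (ψ ⟨$⟩ʳ_) × IsFullCycle (cycleProduct d m ψ a b))
  wAct-fullCycle⇔ a⊥m = ⇔-×ʳ-trans skew⇔ (⇔-sym ∘ conjugate)
    where
    g-injective : ∀ i → Injective _≡_ _≡_ (g i)
    g-injective i = hol-injective (b i) (a⊥m i)
    skew⇔ : IsFullCycle (wAct d m ψ a b) ⇔ (IsFullCycle (ψ ⟨$⟩ʳ_) × IsFullCycle (transport ψ g o d))
    skew⇔ = skew-fullCycle⇔ ψ g o origin (λ i → injective⇒surjective (g i) (g-injective i))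
    conjugate : IsFullCycle (ψ ⟨$⟩ʳ_) →
                IsFullCycle (cycleProduct d m ψ a b) ⇔ IsFullCycle (transport ψ g o d)
    conjugate ψ-full = fullCycle-conjugate (g o) (g-injective o) (injective⇒surjective (g o) (g-injective o))
      λ x → sym (trans (transport-cycAct d x)
                       (cong (λ j → g j (cycleProduct d m ψ a b x))
                             (fullCycle⇒returns _ (⟨$⟩ʳ-injective ψ) o ψ-full)))

  linearPart≡sum : ∀ n → linearPart n ≡ sum (λ (t : Fin n) → α (toℕ t))
  linearPart≡sum zero    = refl
  linearPart≡sum (suc n) = begin
    α n * linearPart n                  ≡⟨ *-comm (α n) _ ⟩
    linearPart n * α n                  ≡⟨ cong₂ _*_ (linearPart≡sum n) (cong α (sym (toℕ-fromℕ n))) ⟩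
    sum {n} (α ∘ toℕ) * f (fromℕ n)     ≡⟨ cong (_* f (fromℕ n)) (sum-cong-≗ {n} {α ∘ toℕ} {f ∘ inject₁} λ t →
                                             cong α (sym (toℕ-inject₁ t))) ⟩
    sum {n} (f ∘ inject₁) * f (fromℕ n) ≡⟨ sum-init-last f ⟨
    sum f                               ∎
    where
    open ≡-Reasoning
    f : Fin (suc n) → ℕ
    f = α ∘ toℕ

  ΠFin≡linearPart : IsFullCycle (ψ ⟨$⟩ʳ_) → ΠFin d a ≡ linearPart d
  ΠFin≡linearPart ψ-full = begin
    ΠFin d a       ≡⟨ ΠFin≡sum d a ⟩
    sum a          ≡⟨ sum-permute a (injective⇒permutation index (fullCycle⇒orbit-injective _ ψ-inj o ψ-full)) ⟩
    sum (a ∘ index) ≡⟨ linearPart≡sum d ⟨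
    linearPart d   ∎
    where
    open ≡-Reasoning
    ψ-inj : Injective _≡_ _≡_ (ψ ⟨$⟩ʳ_)
    ψ-inj = ⟨$⟩ʳ-injective ψ
    index : Fin d → Fin d
    index = orbit _ ψ-inj o

  private
    term : ℕ → ℕ → ℕ
    term n j = prodFrom (suc j) (n ∸ suc j) α * β j

    term-suc : ∀ {n j} → j < n → term (suc n) j ≡ α n * term n j
    term-suc {n} {j} j<n = begin
      prodFrom (suc j) (n ∸ j) α * β j
        ≡⟨ cong (λ k → prodFrom (suc j) k α * β j) (+-∸-assoc 1 j<n) ⟩
      prodFrom (suc j) (suc (n ∸ suc j)) α * β j
        ≡⟨ cong (_* β j) (prodFrom-snoc (suc j) (n ∸ suc j) α) ⟩
      prodFrom (suc j) (n ∸ suc j) α * α (suc j + (n ∸ suc j)) * β j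
        ≡⟨ cong (λ k → prodFrom (suc j) (n ∸ suc j) α * α k * β j) (m+[n∸m]≡n j<n) ⟩
      prodFrom (suc j) (n ∸ suc j) α * α n * β j
        ≡⟨ rotate (prodFrom (suc j) (n ∸ suc j) α) (α n) (β j) ⟩
      α n * term n j
        ∎
      where
      open ≡-Reasoning
      rotate : ∀ p x y → p * x * y ≡ x * (p * y)
      rotate = solve-∀

    term-last : ∀ n → term (suc n) n ≡ β n
    term-last n = trans (cong (λ k → prodFrom (suc n) k α * β n) (n∸n≡0 n)) (*-identityˡ (β n))

    translationPart≡sumTo : ∀ n → translationPart n ≡ sumTo n (term n)
    translationPart≡sumTo zero    = refl
    translationPart≡sumTo (suc n) = begin
      α n * translationPart n + β n          ≡⟨ cong (λ s → α n * s + β n) (translationPart≡sumTo n) ⟩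
      α n * sumTo n (term n) + β n           ≡⟨ cong (_+ β n) (sumTo-*ˡ n (α n) (term n)) ⟨
      sumTo n (λ j → α n * term n j) + β n   ≡⟨ cong₂ _+_ (sumTo-cong n (sym ∘ term-suc)) (sym (term-last n)) ⟩
      sumTo n (term (suc n)) + term (suc n) n ∎
      where open ≡-Reasoning

  cycleProduct≡hol : IsFullCycle (ψ ⟨$⟩ʳ_) →
                     ∀ x → cycleProduct d m ψ a b x ≡ hol m (ΠFin d a) (cycleB d m ψ a b) x
  cycleProduct≡hol ψ-full x = trans (cycAct≡hol d x)
    (cong₂ (λ a′ b′ → hol m a′ b′ x) (sym (ΠFin≡linearPart ψ-full)) (translationPart≡sumTo d))

lemma6p20 : (d m : ℕ) → .{{_ : NonZero d}} → .{{_ : NonZero m}} →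
    (ψ : Permutation′ d) (a b : Fin d → ℕ) → (∀ i → Coprime (a i) m) →
    -- (1)
    ((IsFullCycle (wAct d m ψ a b)
        ⇔ (IsFullCycle (ψ ⟨$⟩ʳ_) × IsFullCycle (cycleProduct d m ψ a b)))
     × (IsFullCycle (wAct d m ψ a b)
        ⇔ (IsFullCycle (ψ ⟨$⟩ʳ_)
           × ((+ rad′ m) ℤ.∣ (+ ΠFin d a - + 1))
           × gcd m (cycleB d m ψ a b) ≡ 1)))
    -- (2)
    × ((∀ p → wAct d m ψ a b (wAct d m ψ a b p) ≡ p)
        ⇔ ((∀ i → ψ ⟨$⟩ʳ (ψ ⟨$⟩ʳ i) ≡ i)
           × (∀ i → ψ ⟨$⟩ʳ i ≢ i →
                ∀ x → hol m (a (ψ ⟨$⟩ʳ i)) (b (ψ ⟨$⟩ʳ i)) (hol m (a i) (b i) x) ≡ x)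
           × (∀ i → ψ ⟨$⟩ʳ i ≡ i →
                ∀ x → hol m (a i) (b i) (hol m (a i) (b i) x) ≡ x)))
lemma6p20 d m ψ a b a⊥m =
  (wAct⇔ , ⇔-×ʳ-trans wAct⇔ cycleProduct⇔conditions) , skew-involutive⇔ ψ (λ i → hol m (a i) (b i)) origin
  where
  wAct⇔ : IsFullCycle (wAct d m ψ a b) ⇔ (IsFullCycle (ψ ⟨$⟩ʳ_) × IsFullCycle (cycleProduct d m ψ a b))
  wAct⇔ = wAct-fullCycle⇔ ψ a b a⊥m
  cycleProduct⇔conditions : IsFullCycle (ψ ⟨$⟩ʳ_) → IsFullCycle (cycleProduct d m ψ a b) ⇔
                            ((+ rad′ m) ℤ.∣ (+ ΠFin d a - + 1) × gcd m (cycleB d m ψ a b) ≡ 1)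
  cycleProduct⇔conditions ψ-full = ⇔-trans (IsFullCycle-cong (cycleProduct≡hol ψ a b ψ-full))
                                           (hullDobell (cycleB d m ψ a b) (ΠFin-coprime d a⊥m))
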